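{- Let $k$ be an odd positive integer and suppose $k^2=a^2+b^2+c^2=a'^2+b'^2+c'^2$ with $a,b,c,a',b',c'\in\mathbb Z$, $\gcd(a,b,c,a',b',c')=1$, $c'>c$, and $a,a'$ both odd. Set $$\Delta_{12}=\tfrac{a'-a}{2},\ \Delta_{34}=\tfrac{a+a'}{2},\ \Delta_{13}=-\tfrac{b'-b}{2},\ \Delta_{24}=\tfrac{b+b'}{2},\ \Delta_{14}=\tfrac{c+c'}{2},\ \Delta_{23}=\tfrac{c'-c}{2}.$$ Then these are integers satisfying $$\Delta_{12}\Delta_{34}-\Delta_{13}\Delta_{24}+\Delta_{14}\Delta_{23}=0$$ and, for both choices of signs, $$k^2=(\Delta_{12}\pm \Delta_{34})^2+(\Delta_{13}\mp\Delta_{24})^2+(\Delta_{14}\pm\Delta_{23})^2.$$ Moreover, the set $\mathcal S$ of all $[u,v,w,t]\in\mathbb Z^4$ such that $$\Delta_{34}v+\Delta_{24}w+\Delta_{23}t=0\quad\text{and}\quad \Delta_{23}u+\Delta_{13}v+\Delta_{12}w=0$$ (a rank-two lattice) contains lattice squares: there exist nonzero $x,y\in\mathcal S$ with $x\cdot y=0$ and $|x|^2=|y|^2$. -}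

module Defs where

open import Data.Integer using (ℤ; +_; _+_; _*_; _-_; -_; ∣_∣; 0ℤ)
open import Data.Nat using (ℕ)
open import Data.Nat.GCD using (gcd)
open import Data.Vec using (Vec; []; _∷_)
open import Data.Product using (∃; _×_)
open import Relation.Binary.PropositionalEquality using (_≡_)

Oddℤ : ℤ → Set
Oddℤ a = ∃ λ m → a ≡ + 1 + + 2 * m

gcd6 : ℤ → ℤ → ℤ → ℤ → ℤ → ℤ → ℕ
gcd6 a b c a' b' c' =
  gcd ∣ a ∣ (gcd ∣ b ∣ (gcd ∣ c ∣ (gcd ∣ a' ∣ (gcd ∣ b' ∣ ∣ c' ∣))))

sq : ℤ → ℤ
sq x = x * x

dot : Vec ℤ 4 → Vec ℤ 4 → ℤ
dot (x₁ ∷ x₂ ∷ x₃ ∷ x₄ ∷ []) (y₁ ∷ y₂ ∷ y₃ ∷ y₄ ∷ []) =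
  x₁ * y₁ + x₂ * y₂ + x₃ * y₃ + x₄ * y₄

zero4 : Vec ℤ 4
zero4 = 0ℤ ∷ 0ℤ ∷ 0ℤ ∷ 0ℤ ∷ []

InS : (d12 d13 d23 d24 d34 : ℤ) → Vec ℤ 4 → Set
InS d12 d13 d23 d24 d34 (u ∷ v ∷ w ∷ t ∷ []) =
  (d34 * v + d24 * w + d23 * t ≡ 0ℤ) × (d23 * u + d13 * v + d12 * w ≡ 0ℤ)

-- Odd squares are 1 mod 4, so b² + c² = k² − a² ≡ 0 (mod 4) forces b and c (and likewise
-- b', c') to be even; hence all Δ's are integers. The sums Δ12 + Δ34, Δ13 − Δ24, Δ14 + Δ23
-- are a', −b', c' and the differences are −a, b, c, so both sign choices give k², and
-- subtracting the two expressions gives 4 (Δ12 Δ34 − Δ13 Δ24 + Δ14 Δ23) = 0.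
-- The lattice S contains x₀ = (−Δ13, Δ23, 0, −Δ34) and y₀ = (−Δ12, 0, Δ23, −Δ24), whose Gram
-- determinant is (Δ23 k)² by a Lagrange-type identity and the Plücker relation. With s = Δ23 k,
-- the vectors s x₀ and |x₀|² y₀ − (x₀·y₀) x₀ (Gram–Schmidt without division) are then
-- orthogonal of common norm s² |x₀|², which is nonzero because c < c' gives Δ23 ≠ 0.
module Submission where

open import Defs
open import Data.Nat using (ℕ; zero; suc; s≤s; z≤n)
open import Data.Integer
  using (ℤ; +_; _+_; _*_; _-_; -_; 0ℤ; _<_; _≤_; +≤+; +<+; +[1+_]; -[1+_])
open import Data.Integer.Properties
  using ( +-identityˡ; +-identityʳ; +-comm; *-comm; *-assoc; *-zeroʳ; *-cancelˡ-≡; neg-distribʳ-*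
        ; i≡j⇒i-j≡0; i*j≡0⇒i≡0∨j≡0; <-irrefl; <⇒≢; +-mono-≤-<; +-mono-<-≤)
open import Data.Integer.DivMod using (_%ℕ_; _/ℕ_; n%ℕd<d; a≡a%ℕn+[a/ℕn]*n)
open import Data.Integer.Tactic.RingSolver using (solve-∀)
open import Data.Vec using (Vec; []; _∷_; map; zipWith)
open import Data.Product using (Σ; ∃; _×_; _,_)
open import Data.Sum using (_⊎_; inj₁; inj₂; [_,_])
open import Data.Empty using (⊥-elim)
open import Relation.Binary.PropositionalEquality
  using (_≡_; _≢_; refl; sym; trans; cong; cong₂; module ≡-Reasoning)

Evenℤ : ℤ → Set
Evenℤ z = ∃ λ j → z ≡ + 2 * j

even-or-odd : ∀ z → Evenℤ z ⊎ Oddℤ z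
even-or-odd z with z %ℕ 2 | n%ℕd<d z 2 | a≡a%ℕn+[a/ℕn]*n z 2
... | 0           | _               | z≡ = inj₁ (z /ℕ 2 , trans z≡ (trans (+-identityˡ _) (*-comm (z /ℕ 2) (+ 2))))
... | 1           | _               | z≡ = inj₂ (z /ℕ 2 , trans z≡ (cong (λ q → + 1 + q) (*-comm (z /ℕ 2) (+ 2))))
... | suc (suc _) | s≤s (s≤s ())    | _

odd≢0 : ∀ w → + 1 + + 2 * w ≢ 0ℤ
odd≢0 (+ zero)     ()
odd≢0 +[1+ n ]     ()
odd≢0 -[1+ zero ]  ()
odd≢0 -[1+ suc n ] ()

odd⇒≢0 : ∀ {x} → Oddℤ x → x ≢ 0ℤ
odd⇒≢0 (n , refl) = odd≢0 n

odd≢even : ∀ x y → + 1 + + 2 * x ≢ + 2 * y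
odd≢even x y e = odd≢0 (x - y) (trans (shift x y) (i≡j⇒i-j≡0 e))
  where
  shift : ∀ x y → + 1 + + 2 * (x - y) ≡ (+ 1 + + 2 * x) - + 2 * y
  shift = solve-∀

-- Ring identities are stated with x * x rather than sq x: the ring solver cannot unfold sq.
even+odd≢4* : ∀ j l q → sq (+ 2 * j) + sq (+ 1 + + 2 * l) ≢ + 4 * q
even+odd≢4* j l q e =
  odd≢even (+ 2 * (j * j + l * l + l)) (+ 2 * q) (trans (sym (expand j l)) (trans e (*-assoc (+ 2) (+ 2) q)))
  where
  expand : ∀ j l → + 2 * j * (+ 2 * j) + (+ 1 + + 2 * l) * (+ 1 + + 2 * l)
                 ≡ + 1 + + 2 * (+ 2 * (j * j + l * l + l))
  expand = solve-∀

odd+odd≢4* : ∀ j l q → sq (+ 1 + + 2 * j) + sq (+ 1 + + 2 * l) ≢ + 4 * q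
odd+odd≢4* j l q e =
  odd≢even (j * j + j + l * l + l) q
    (*-cancelˡ-≡ (+ 2) _ _ (trans (sym (expand j l)) (trans e (*-assoc (+ 2) (+ 2) q))))
  where
  expand : ∀ j l → (+ 1 + + 2 * j) * (+ 1 + + 2 * j) + (+ 1 + + 2 * l) * (+ 1 + + 2 * l)
                 ≡ + 2 * (+ 1 + + 2 * (j * j + j + l * l + l))
  expand = solve-∀

sq+sq≡4*⇒even : ∀ b c q → sq b + sq c ≡ + 4 * q → Evenℤ b × Evenℤ c
sq+sq≡4*⇒even b c q h with even-or-odd b | even-or-odd c
... | inj₁ b-even     | inj₁ c-even     = b-even , c-even
... | inj₁ (j , refl) | inj₂ (l , refl) = ⊥-elim (even+odd≢4* j l q h)
... | inj₂ (j , refl) | inj₁ (l , refl) =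
  ⊥-elim (even+odd≢4* l j q (trans (+-comm (sq (+ 2 * l)) (sq (+ 1 + + 2 * j))) h))
... | inj₂ (j , refl) | inj₂ (l , refl) = ⊥-elim (odd+odd≢4* j l q h)

legs-even : ∀ {k a b c} → Oddℤ k → Oddℤ a → sq k ≡ sq a + sq b + sq c → Evenℤ b × Evenℤ c
legs-even {b = b} {c} (n , refl) (m , refl) h = sq+sq≡4*⇒even b c _ (begin
  sq b + sq c                                 ≡⟨ isolate (+ 1 + + 2 * m) b c ⟩
  (sq (+ 1 + + 2 * m) + sq b + sq c) - sq (+ 1 + + 2 * m) ≡⟨ cong (_- sq (+ 1 + + 2 * m)) (sym h) ⟩
  sq (+ 1 + + 2 * n) - sq (+ 1 + + 2 * m)     ≡⟨ odd-squares n m ⟩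
  + 4 * (n * n + n - (m * m + m))             ∎)
  where
  open ≡-Reasoning
  isolate : ∀ a b c → b * b + c * c ≡ (a * a + b * b + c * c) - a * a
  isolate = solve-∀
  odd-squares : ∀ n m → (+ 1 + + 2 * n) * (+ 1 + + 2 * n) - (+ 1 + + 2 * m) * (+ 1 + + 2 * m)
                      ≡ + 4 * (n * n + n - (m * m + m))
  odd-squares = solve-∀

odd-gap : ∀ {x y} → Oddℤ x → Oddℤ y → ∃ λ t → y ≡ x + + 2 * t
odd-gap (m , refl) (m' , refl) = m' - m , gap m m'
  where
  gap : ∀ m m' → + 1 + + 2 * m' ≡ + 1 + + 2 * m + + 2 * (m' - m)
  gap = solve-∀

even-gap : ∀ {x y} → Evenℤ x → Evenℤ y → ∃ λ t → y ≡ x + + 2 * t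
even-gap (j , refl) (j' , refl) = j' - j , gap j j'
  where
  gap : ∀ j j' → + 2 * j' ≡ + 2 * j + + 2 * (j' - j)
  gap = solve-∀

half-difference : ∀ x t → + 2 * t ≡ (x + + 2 * t) - x
half-difference = solve-∀

half-sum : ∀ x t → + 2 * (x + t) ≡ x + (x + + 2 * t)
half-sum = solve-∀

norm-as-sums : ∀ a t b u c v →
  (a + + 2 * t) * (a + + 2 * t) + (b + + 2 * u) * (b + + 2 * u) + (c + + 2 * v) * (c + + 2 * v)
  ≡ (t + (a + t)) * (t + (a + t)) + (- u - (b + u)) * (- u - (b + u)) + (c + v + v) * (c + v + v)
norm-as-sums = solve-∀

norm-as-differences : ∀ a t b u c v →
  a * a + b * b + c * c
  ≡ (t - (a + t)) * (t - (a + t)) + (- u + (b + u)) * (- u + (b + u)) + (c + v - v) * (c + v - v)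
norm-as-differences = solve-∀

equal-norms⇒plücker : ∀ d12 d34 d13 d24 d14 d23 →
  sq (d12 + d34) + sq (d13 - d24) + sq (d14 + d23) ≡ sq (d12 - d34) + sq (d13 + d24) + sq (d14 - d23) →
  d12 * d34 - d13 * d24 + d14 * d23 ≡ 0ℤ
equal-norms⇒plücker d12 d34 d13 d24 d14 d23 e =
  *-cancelˡ-≡ (+ 4) _ 0ℤ (trans (four-plücker d12 d34 d13 d24 d14 d23) (i≡j⇒i-j≡0 e))
  where
  four-plücker : ∀ d12 d34 d13 d24 d14 d23 →
    + 4 * (d12 * d34 - d13 * d24 + d14 * d23)
    ≡ ((d12 + d34) * (d12 + d34) + (d13 - d24) * (d13 - d24) + (d14 + d23) * (d14 + d23))
      - ((d12 - d34) * (d12 - d34) + (d13 + d24) * (d13 + d24) + (d14 - d23) * (d14 - d23))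
  four-plücker = solve-∀

i<i+2j⇒j≢0 : ∀ c v → c < c + + 2 * v → v ≢ 0ℤ
i<i+2j⇒j≢0 c v c<c+2v refl = <-irrefl (sym (+-identityʳ c)) c<c+2v

infixr 7 _•_
infixl 6 _⊕_

_•_ : ℤ → Vec ℤ 4 → Vec ℤ 4
s • x = map (s *_) x

_⊕_ : Vec ℤ 4 → Vec ℤ 4 → Vec ℤ 4
_⊕_ = zipWith _+_

dot-comm : ∀ x y → dot x y ≡ dot y x
dot-comm (x₁ ∷ x₂ ∷ x₃ ∷ x₄ ∷ []) (y₁ ∷ y₂ ∷ y₃ ∷ y₄ ∷ []) = comm x₁ x₂ x₃ x₄ y₁ y₂ y₃ y₄
  where
  comm : ∀ x₁ x₂ x₃ x₄ y₁ y₂ y₃ y₄ →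
    x₁ * y₁ + x₂ * y₂ + x₃ * y₃ + x₄ * y₄ ≡ y₁ * x₁ + y₂ * x₂ + y₃ * x₃ + y₄ * x₄
  comm = solve-∀

dot-•ʳ : ∀ s x y → dot x (s • y) ≡ s * dot x y
dot-•ʳ s (x₁ ∷ x₂ ∷ x₃ ∷ x₄ ∷ []) (y₁ ∷ y₂ ∷ y₃ ∷ y₄ ∷ []) = scale s x₁ x₂ x₃ x₄ y₁ y₂ y₃ y₄
  where
  scale : ∀ s x₁ x₂ x₃ x₄ y₁ y₂ y₃ y₄ →
    x₁ * (s * y₁) + x₂ * (s * y₂) + x₃ * (s * y₃) + x₄ * (s * y₄)
    ≡ s * (x₁ * y₁ + x₂ * y₂ + x₃ * y₃ + x₄ * y₄)
  scale = solve-∀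

dot-•ˡ : ∀ s x y → dot (s • x) y ≡ s * dot x y
dot-•ˡ s x y = trans (dot-comm (s • x) y) (trans (dot-•ʳ s y x) (cong (s *_) (dot-comm y x)))

dot-⊕ʳ : ∀ x y z → dot x (y ⊕ z) ≡ dot x y + dot x z
dot-⊕ʳ (x₁ ∷ x₂ ∷ x₃ ∷ x₄ ∷ []) (y₁ ∷ y₂ ∷ y₃ ∷ y₄ ∷ []) (z₁ ∷ z₂ ∷ z₃ ∷ z₄ ∷ []) =
  distrib x₁ x₂ x₃ x₄ y₁ y₂ y₃ y₄ z₁ z₂ z₃ z₄
  where
  distrib : ∀ x₁ x₂ x₃ x₄ y₁ y₂ y₃ y₄ z₁ z₂ z₃ z₄ →
    x₁ * (y₁ + z₁) + x₂ * (y₂ + z₂) + x₃ * (y₃ + z₃) + x₄ * (y₄ + z₄)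
    ≡ (x₁ * y₁ + x₂ * y₂ + x₃ * y₃ + x₄ * y₄) + (x₁ * z₁ + x₂ * z₂ + x₃ * z₃ + x₄ * z₄)
  distrib = solve-∀

dot-combinationʳ : ∀ x α y β z → dot x (α • y ⊕ β • z) ≡ α * dot x y + β * dot x z
dot-combinationʳ x α y β z =
  trans (dot-⊕ʳ x (α • y) (β • z)) (cong₂ _+_ (dot-•ʳ α x y) (dot-•ʳ β x z))

dot≢0⇒≢zero4 : ∀ x → dot x x ≢ 0ℤ → x ≢ zero4
dot≢0⇒≢zero4 x dot≢0 refl = dot≢0 refl

gram : Vec ℤ 4 → Vec ℤ 4 → ℤ
gram x y = dot x x * dot y y - dot x y * dot x y

orthogonalise : Vec ℤ 4 → Vec ℤ 4 → Vec ℤ 4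
orthogonalise x y = (- dot x y) • x ⊕ dot x x • y

dot-orthogonalise : ∀ x y → dot x (orthogonalise x y) ≡ 0ℤ
dot-orthogonalise x y =
  trans (dot-combinationʳ x (- dot x y) x (dot x x) y) (cancel (dot x x) (dot x y))
  where
  cancel : ∀ A B → - B * A + A * B ≡ 0ℤ
  cancel = solve-∀

dot-orthogonalise-self : ∀ x y → dot (orthogonalise x y) (orthogonalise x y) ≡ dot x x * gram x y
dot-orthogonalise-self x y = begin
  dot y′ y′                                     ≡⟨ dot-combinationʳ y′ (- B) x A y ⟩
  - B * dot y′ x + A * dot y′ y                 ≡⟨ cong₂ (λ p q → - B * p + A * q) y′⊥x y′·y ⟩
  - B * 0ℤ + A * (- B * B + A * dot y y)        ≡⟨ expand A B (dot y y) ⟩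
  A * (A * dot y y - B * B)                     ∎
  where
  open ≡-Reasoning
  A B : ℤ
  A = dot x x
  B = dot x y
  y′ : Vec ℤ 4
  y′ = orthogonalise x y
  y′⊥x : dot y′ x ≡ 0ℤ
  y′⊥x = trans (dot-comm y′ x) (dot-orthogonalise x y)
  y′·y : dot y′ y ≡ - B * B + A * dot y y
  y′·y = trans (dot-comm y′ y) (trans (dot-combinationʳ y (- B) x A y)
           (cong (λ p → - B * p + A * dot y y) (dot-comm y x)))
  expand : ∀ A B C → - B * 0ℤ + A * (- B * B + A * C) ≡ A * (A * C - B * B)
  expand = solve-∀

*-≢0 : ∀ {i j} → i ≢ 0ℤ → j ≢ 0ℤ → i * j ≢ 0ℤ
*-≢0 {i} i≢0 j≢0 ij≡0 = [ i≢0 , j≢0 ] (i*j≡0⇒i≡0∨j≡0 i ij≡0)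

form≡0-• : ∀ p q r s x₁ x₂ x₃ → p * x₁ + q * x₂ + r * x₃ ≡ 0ℤ →
           p * (s * x₁) + q * (s * x₂) + r * (s * x₃) ≡ 0ℤ
form≡0-• p q r s x₁ x₂ x₃ h =
  trans (factor p q r s x₁ x₂ x₃) (trans (cong (s *_) h) (*-zeroʳ s))
  where
  factor : ∀ p q r s x₁ x₂ x₃ →
    p * (s * x₁) + q * (s * x₂) + r * (s * x₃) ≡ s * (p * x₁ + q * x₂ + r * x₃)
  factor = solve-∀

form≡0-+ : ∀ p q r x₁ x₂ x₃ y₁ y₂ y₃ → p * x₁ + q * x₂ + r * x₃ ≡ 0ℤ → p * y₁ + q * y₂ + r * y₃ ≡ 0ℤ →
           p * (x₁ + y₁) + q * (x₂ + y₂) + r * (x₃ + y₃) ≡ 0ℤ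
form≡0-+ p q r x₁ x₂ x₃ y₁ y₂ y₃ hx hy =
  trans (split p q r x₁ x₂ x₃ y₁ y₂ y₃) (cong₂ _+_ hx hy)
  where
  split : ∀ p q r x₁ x₂ x₃ y₁ y₂ y₃ →
    p * (x₁ + y₁) + q * (x₂ + y₂) + r * (x₃ + y₃) ≡ (p * x₁ + q * x₂ + r * x₃) + (p * y₁ + q * y₂ + r * y₃)
  split = solve-∀

module Lattice (d12 d13 d23 d24 d34 : ℤ) where

  S : Vec ℤ 4 → Set
  S = InS d12 d13 d23 d24 d34

  S-• : ∀ s x → S x → S (s • x)
  S-• s (u ∷ v ∷ w ∷ t ∷ []) (h₁ , h₂) = form≡0-• d34 d24 d23 s v w t h₁ , form≡0-• d23 d13 d12 s u v w h₂

  S-⊕ : ∀ x y → S x → S y → S (x ⊕ y)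
  S-⊕ (u ∷ v ∷ w ∷ t ∷ []) (u′ ∷ v′ ∷ w′ ∷ t′ ∷ []) (h₁ , h₂) (h₁′ , h₂′) =
    form≡0-+ d34 d24 d23 v w t v′ w′ t′ h₁ h₁′ , form≡0-+ d23 d13 d12 u v w u′ v′ w′ h₂ h₂′

  S-orthogonalise : ∀ x y → S x → S y → S (orthogonalise x y)
  S-orthogonalise x y x∈S y∈S =
    S-⊕ (- dot x y • x) (dot x x • y) (S-• (- dot x y) x x∈S) (S-• (dot x x) y y∈S)

  squares-of-square-gram : ∀ s x y → S x → S y → s ≢ 0ℤ → dot x x ≢ 0ℤ → gram x y ≡ s * s →
    Σ (Vec ℤ 4) λ x′ → Σ (Vec ℤ 4) λ y′ →
      S x′ × S y′ × x′ ≢ zero4 × y′ ≢ zero4 × dot x′ y′ ≡ 0ℤ × dot x′ x′ ≡ dot y′ y′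
  squares-of-square-gram s x y x∈S y∈S s≢0 A≢0 gram≡s² =
    s • x , y′ , S-• s x x∈S , S-orthogonalise x y x∈S y∈S ,
    dot≢0⇒≢zero4 (s • x) x′·x′≢0 ,
    dot≢0⇒≢zero4 y′ (λ y′·y′≡0 → x′·x′≢0 (trans equal-norms y′·y′≡0)) ,
    trans (dot-•ˡ s x y′) (trans (cong (s *_) (dot-orthogonalise x y)) (*-zeroʳ s)) ,
    equal-norms
    where
    open ≡-Reasoning
    A : ℤ
    A = dot x x
    y′ : Vec ℤ 4
    y′ = orthogonalise x y
    x′·x′ : dot (s • x) (s • x) ≡ s * (s * A)
    x′·x′ = trans (dot-•ˡ s x (s • x)) (cong (s *_) (dot-•ʳ s x x))
    x′·x′≢0 : dot (s • x) (s • x) ≢ 0ℤ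
    x′·x′≢0 e = *-≢0 s≢0 (*-≢0 s≢0 A≢0) (trans (sym x′·x′) e)
    equal-norms : dot (s • x) (s • x) ≡ dot y′ y′
    equal-norms = begin
      dot (s • x) (s • x)   ≡⟨ x′·x′ ⟩
      s * (s * A)           ≡⟨ rearrange s A ⟩
      A * (s * s)           ≡⟨ cong (A *_) gram≡s² ⟨
      A * gram x y          ≡⟨ dot-orthogonalise-self x y ⟨
      dot y′ y′             ∎
      where
      rearrange : ∀ s A → s * (s * A) ≡ A * (s * s)
      rearrange = solve-∀

0≤sq : ∀ i → 0ℤ ≤ sq i
0≤sq (+ zero)   = +≤+ z≤n
0≤sq +[1+ _ ]   = +≤+ z≤n
0≤sq -[1+ _ ]   = +≤+ z≤n

0<sq : ∀ {i} → i ≢ 0ℤ → 0ℤ < sq i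
0<sq {+ zero}   i≢0 = ⊥-elim (i≢0 refl)
0<sq {+[1+ _ ]} _   = +<+ (s≤s z≤n)
0<sq { -[1+ _ ]} _  = +<+ (s≤s z≤n)

plücker⇒lattice-squares : ∀ k d12 d34 d13 d24 d14 d23 →
  sq k ≡ sq (d12 + d34) + sq (d13 - d24) + sq (d14 + d23) →
  d12 * d34 - d13 * d24 + d14 * d23 ≡ 0ℤ → d23 ≢ 0ℤ → k ≢ 0ℤ →
  Σ (Vec ℤ 4) λ x → Σ (Vec ℤ 4) λ y →
    InS d12 d13 d23 d24 d34 x × InS d12 d13 d23 d24 d34 y
    × x ≢ zero4 × y ≢ zero4 × dot x y ≡ 0ℤ × dot x x ≡ dot y y
plücker⇒lattice-squares k d12 d34 d13 d24 d14 d23 norm plücker d23≢0 k≢0 =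
  squares-of-square-gram (d23 * k) x₀ y₀ x₀∈S y₀∈S (*-≢0 d23≢0 k≢0) x₀·x₀≢0 gram≡
  where
  open Lattice d12 d13 d23 d24 d34
  open ≡-Reasoning
  -- the solutions of the two equations defining S with w = 0 and with v = 0
  x₀ y₀ : Vec ℤ 4
  x₀ = - d13 ∷ d23 ∷ 0ℤ ∷ - d34 ∷ []
  y₀ = - d12 ∷ 0ℤ ∷ d23 ∷ - d24 ∷ []
  cancel₁ : ∀ p q r → p * q + r * 0ℤ + q * - p ≡ 0ℤ
  cancel₁ = solve-∀
  cancel₂ : ∀ p q r → q * - p + p * q + r * 0ℤ ≡ 0ℤ
  cancel₂ = solve-∀
  cancel₃ : ∀ p q r → r * 0ℤ + p * q + q * - p ≡ 0ℤ
  cancel₃ = solve-∀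
  cancel₄ : ∀ p q r → q * - p + r * 0ℤ + p * q ≡ 0ℤ
  cancel₄ = solve-∀
  x₀∈S : S x₀
  x₀∈S = cancel₁ d34 d23 d24 , cancel₂ d13 d23 d12
  y₀∈S : S y₀
  y₀∈S = cancel₃ d24 d23 d34 , cancel₄ d12 d23 d13
  x₀·x₀≢0 : dot x₀ x₀ ≢ 0ℤ
  x₀·x₀≢0 e = <⇒≢ 0<x₀·x₀ (sym e)
    where
    0<x₀·x₀ : 0ℤ < dot x₀ x₀
    0<x₀·x₀ = +-mono-<-≤ (+-mono-<-≤ (+-mono-≤-< (0≤sq (- d13)) (0<sq d23≢0)) (0≤sq 0ℤ)) (0≤sq (- d34))
  gram≡ : gram x₀ y₀ ≡ d23 * k * (d23 * k)
  gram≡ = begin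
    gram x₀ y₀                                    ≡⟨ lagrange d12 d34 d13 d24 d14 d23 ⟩
    sq d23 * N⁺ - P * (+ 2 * d23 * (d23 + d14) - P)  ≡⟨ cong (λ p → sq d23 * N⁺ - p * (+ 2 * d23 * (d23 + d14) - p)) plücker ⟩
    sq d23 * N⁺ - 0ℤ * (+ 2 * d23 * (d23 + d14) - 0ℤ) ≡⟨ drop (sq d23 * N⁺) (+ 2 * d23 * (d23 + d14) - 0ℤ) ⟩
    sq d23 * N⁺                                   ≡⟨ cong (sq d23 *_) norm ⟨
    sq d23 * sq k                                 ≡⟨ regroup d23 k ⟩
    d23 * k * (d23 * k)                           ∎
    where
    P N⁺ : ℤ
    P = d12 * d34 - d13 * d24 + d14 * d23
    N⁺ = sq (d12 + d34) + sq (d13 - d24) + sq (d14 + d23)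
    lagrange : ∀ d12 d34 d13 d24 d14 d23 →
      ((- d13) * (- d13) + d23 * d23 + 0ℤ * 0ℤ + (- d34) * (- d34))
        * ((- d12) * (- d12) + 0ℤ * 0ℤ + d23 * d23 + (- d24) * (- d24))
      - ((- d13) * (- d12) + d23 * 0ℤ + 0ℤ * d23 + (- d34) * (- d24))
        * ((- d13) * (- d12) + d23 * 0ℤ + 0ℤ * d23 + (- d34) * (- d24))
      ≡ d23 * d23 * ((d12 + d34) * (d12 + d34) + (d13 - d24) * (d13 - d24) + (d14 + d23) * (d14 + d23))
        - (d12 * d34 - d13 * d24 + d14 * d23)
          * (+ 2 * d23 * (d23 + d14) - (d12 * d34 - d13 * d24 + d14 * d23))
    lagrange = solve-∀
    drop : ∀ u v → u - 0ℤ * v ≡ u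
    drop = solve-∀
    regroup : ∀ d k → d * d * (k * k) ≡ d * k * (d * k)
    regroup = solve-∀

theorem2p8 : (k : ℕ) → Oddℤ (+ k) →
    (a b c a' b' c' : ℤ) →
    sq (+ k) ≡ sq a + sq b + sq c →
    sq (+ k) ≡ sq a' + sq b' + sq c' →
    gcd6 a b c a' b' c' ≡ 1 →
    c < c' →
    Oddℤ a → Oddℤ a' →
    Σ ℤ λ d12 → Σ ℤ λ d34 → Σ ℤ λ d13 → Σ ℤ λ d24 → Σ ℤ λ d14 → Σ ℤ λ d23 →
      ((+ 2 * d12 ≡ a' - a) × (+ 2 * d34 ≡ a + a') × (+ 2 * d13 ≡ - (b' - b))
        × (+ 2 * d24 ≡ b + b') × (+ 2 * d14 ≡ c + c') × (+ 2 * d23 ≡ c' - c))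
      × (d12 * d34 - d13 * d24 + d14 * d23 ≡ 0ℤ)
      × (sq (+ k) ≡ sq (d12 + d34) + sq (d13 - d24) + sq (d14 + d23))
      × (sq (+ k) ≡ sq (d12 - d34) + sq (d13 + d24) + sq (d14 - d23))
      × (Σ (Vec ℤ 4) λ x → Σ (Vec ℤ 4) λ y →
           InS d12 d13 d23 d24 d34 x × InS d12 d13 d23 d24 d34 y
           × x ≢ zero4 × y ≢ zero4
           × dot x y ≡ 0ℤ × dot x x ≡ dot y y)
theorem2p8 k k-odd a b c a' b' c' norm norm' _ c<c' a-odd a'-odd
  with legs-even k-odd a-odd norm | legs-even k-odd a'-odd norm'
... | b-even , c-even | b'-even , c'-even
  with odd-gap a-odd a'-odd | even-gap {b} {b'} b-even b'-even | even-gap {c} {c'} c-even c'-even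
... | t , refl | u , refl | v , refl =
  t , a + t , - u , b + u , c + v , v ,
  (half-difference a t , half-sum a t , Δ13-halving , half-sum b u , half-sum c v , half-difference c v) ,
  plücker , norm⁺ , norm⁻ ,
  plücker⇒lattice-squares (+ k) t (a + t) (- u) (b + u) (c + v) v
    norm⁺ plücker (i<i+2j⇒j≢0 c v c<c') (odd⇒≢0 k-odd)
  where
  Δ13-halving : + 2 * - u ≡ - ((b + + 2 * u) - b)
  Δ13-halving = trans (sym (neg-distribʳ-* (+ 2) u)) (cong -_ (half-difference b u))
  norm⁺ : sq (+ k) ≡ sq (t + (a + t)) + sq (- u - (b + u)) + sq (c + v + v)
  norm⁺ = trans norm' (norm-as-sums a t b u c v)
  norm⁻ : sq (+ k) ≡ sq (t - (a + t)) + sq (- u + (b + u)) + sq (c + v - v)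
  norm⁻ = trans norm (norm-as-differences a t b u c v)
  plücker : t * (a + t) - - u * (b + u) + (c + v) * v ≡ 0ℤ
  plücker = equal-norms⇒plücker t (a + t) (- u) (b + u) (c + v) v (trans (sym norm⁺) norm⁻)
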